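{- For integers $n$ and $k\ge0$, let $D(n,k)$ be the number of sequences $(x_1,\dots,x_k)\in\{ -1,2\}^k$ such that, with $S_0=0$ and $S_j=x_1+\dots+x_j$, we have $S_j<n$ for all $j=0,1,\dots,k$ and $S_k\in\{n-1,n-2\}$. Then for all integers $n\ge 2$ and $k\ge 0$, \[D(n,k)=D(n-1,k+1)-D(n-3,k),\] with $D(-1,k)=D(0,k)=0$ for all $k\ge0$, and for all $m\ge0$, \[D(1,3m)=\frac{1}{2m+1}\binom{3m}{m},\qquad D(1,3m+1)=\frac{1}{2m+1}\binom{3m+1}{m+1},\qquad D(1,3m+2)=0.\]
   Context: $D(n,k)$ counts the ways a player who each move either adds $2$ chips or removes $1$ chip (starting from $0$ chips, piles may be negative) has $n-1$ or $n-2$ chips after his $k$-th move without ever having collected $n$ chips. -}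

module Defs where

open import Data.Nat using (ℕ; zero; suc)
open import Data.Integer using (ℤ; +_; -[1+_]; _+_; _-_; _<_; _<?_)
import Data.Integer.Properties as ℤP
open import Data.List using (List; []; _∷_; length; filter; map; _++_)
open import Data.List.Relation.Unary.All using (All)
import Data.List.Relation.Unary.All as All
open import Data.Vec using (Vec; []; _∷_)
open import Data.Product using (_×_)
open import Data.Sum using (_⊎_)
open import Relation.Binary.PropositionalEquality using (_≡_)
open import Relation.Nullary using (Dec)
open import Relation.Nullary.Decidable using (_×-dec_; _⊎-dec_)

data Step : Set where
  down up : Step

val : Step → ℤ
val down = -[1+ 0 ]
val up   = + 2

allSeqs : (k : ℕ) → List (Vec Step k)
allSeqs zero    = [] ∷ []
allSeqs (suc k) = map (down ∷_) (allSeqs k) ++ map (up ∷_) (allSeqs k)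

sums : ∀ {k} → ℤ → Vec Step k → List ℤ
sums s []       = s ∷ []
sums s (x ∷ xs) = s ∷ sums (s + val x) xs

final : ∀ {k} → ℤ → Vec Step k → ℤ
final s []       = s
final s (x ∷ xs) = final (s + val x) xs

Good : ℤ → ∀ {k} → Vec Step k → Set
Good n xs = All (_< n) (sums (+ 0) xs)
          × (final (+ 0) xs ≡ n - + 1 ⊎ final (+ 0) xs ≡ n - + 2)

good? : (n : ℤ) → ∀ {k} → (xs : Vec Step k) → Dec (Good n xs)
good? n xs = All.all? (_<? n) (sums (+ 0) xs)
        ×-dec ((final (+ 0) xs ℤP.≟ (n - + 1)) ⊎-dec (final (+ 0) xs ℤP.≟ (n - + 2)))

D : ℤ → ℕ → ℕ
D n k = length (filter (good? n) (allSeqs k))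

-- Writing g = n − s for the distance from the current pile s to the bound n, a counted sequence is a
-- walk of g from n that moves by +1 or −2, stays positive and ends in {1, 2}. Splitting off its first
-- move gives D(n − 1, k + 1) = D(n, k) + D(n − 3, k). Read backwards and shifted down by one it is a
-- path in ℕ with steps −1 and +2 from 0 or 1 to n − 1, so D(1, k) counts such paths from 0 or 1 to 0.
-- A path from h to 0 of length k = 3u + h has u up-steps, and first-step induction together with
-- Pascal's rule shows there are C(k, u) − 2 C(k, u − 1) = (h + 1) C(k, u) / (2u + h + 1) of them; there
-- are none when k ≢ h (mod 3).
module Submission where

open import Defs
open import Data.Nat using (ℕ; zero; suc; _*_) renaming (_+_ to _+ℕ_)
open import Data.Nat.Combinatorics using (_C_)
open import Data.Integer using (ℤ; +_; _-_; _≥_)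
open import Data.Product using (_×_)
open import Relation.Binary.PropositionalEquality using (_≡_)

open import Data.Nat using (_+_; _<_; _%_; NonZero; z≤n; s≤s)
import Data.Nat.Properties as ℕP
open import Data.Nat.DivMod using ([m+kn]%n≡m%n; m<n⇒m%n≡m)
open import Data.Nat.Combinatorics using (nCk+nC[k+1]≡[n+1]C[k+1]; nC1≡n)
open import Data.Nat.Tactic.RingSolver using (solve-∀)
open import Algebra.Properties.CommutativeSemigroup ℕP.+-commutativeSemigroup
  using (interchange)
open import Data.Integer using (+[1+_]; -[1+_])
import Data.Integer as ℤ
import Data.Integer.Properties as ℤP
open import Data.Integer.Tactic.RingSolver renaming (solve-∀ to solveℤ-∀)
open import Data.Bool using (true; false)
open import Data.List using (List; []; _∷_; length; filter; map; _++_)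
open import Data.List.Properties
  using (filter-++; length-++; filter-≐; filter-none; filter-accept; filter-reject)
open import Data.List.Relation.Unary.All using (All; []; _∷_)
import Data.List.Relation.Unary.All as All
open import Data.Vec using (Vec; []; _∷_)
open import Data.Product using (_,_; proj₁; map₁)
open import Data.Sum using (_⊎_; inj₁; inj₂)
import Data.Sum as Sum
open import Data.Empty using (⊥-elim)
open import Function using (_∘_)
open import Relation.Nullary using (Dec; yes; no; ¬_; does)
open import Relation.Nullary.Decidable using (_×-dec_; _⊎-dec_)
open import Relation.Unary using (Decidable)
open import Relation.Binary.PropositionalEquality
  using (_≢_; refl; sym; trans; cong; cong₂; subst; subst₂; module ≡-Reasoning)
open ≡-Reasoning

length-filter-++ : ∀ {A : Set} {P : A → Set} (P? : Decidable P) (xs ys : List A) →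
                   length (filter P? (xs ++ ys)) ≡ length (filter P? xs) + length (filter P? ys)
length-filter-++ P? xs ys = trans (cong length (filter-++ P? xs ys)) (length-++ (filter P? xs))

length-filter-map : ∀ {A B : Set} {P : A → Set} (P? : Decidable P) (f : B → A) (xs : List B) →
                    length (filter P? (map f xs)) ≡ length (filter (P? ∘ f) xs)
length-filter-map P? f []       = refl
length-filter-map P? f (x ∷ xs) with does (P? (f x))
... | true  = cong suc (length-filter-map P? f xs)
... | false = length-filter-map P? f xs

i<j⇒0<j-i : ∀ {i j} → i ℤ.< j → + 0 ℤ.< j - i
i<j⇒0<j-i {i} {j} i<j = subst (ℤ._< j - i) (ℤP.+-inverseʳ i) (ℤP.+-monoˡ-< (ℤ.- i) i<j)

0<j-i⇒i<j : ∀ {i j} → + 0 ℤ.< j - i → i ℤ.< j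
0<j-i⇒i<j {i} {j} 0<j-i = subst₂ ℤ._<_ (ℤP.+-identityʳ i) (i+[j-i]≡j i j) (ℤP.+-monoʳ-< i 0<j-i)
  where
  i+[j-i]≡j : ∀ i j → i ℤ.+ (j - i) ≡ j
  i+[j-i]≡j = solveℤ-∀

j-[j-i]≡i : ∀ j i → j - (j - i) ≡ i
j-[j-i]≡i = solveℤ-∀

residue-unique : ∀ d .{{_ : NonZero d}} a b {r s} → r < d → s < d → d * a + r ≡ d * b + s → r ≡ s
residue-unique d a b {r} {s} r<d s<d eq = begin
  r                ≡⟨ sym (m<n⇒m%n≡m r<d) ⟩
  r % d            ≡⟨ sym ([m+kn]%n≡m%n r a d) ⟩
  (r + a * d) % d  ≡⟨ cong (_% d) (trans (swap r a d) (trans eq (sym (swap s b d)))) ⟩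
  (s + b * d) % d  ≡⟨ [m+kn]%n≡m%n s b d ⟩
  s % d            ≡⟨ m<n⇒m%n≡m s<d ⟩
  s                ∎
  where
  swap : ∀ r a d → r + a * d ≡ d * a + r
  swap = solve-∀

C-pascal : ∀ n k → suc n C suc k ≡ n C k + n C suc k
C-pascal n k = sym (nCk+nC[k+1]≡[n+1]C[k+1] n k)

C-absorb : ∀ n k → suc k * (suc n C suc k) ≡ suc n * (n C k)
C-absorb zero    zero    = refl
C-absorb zero    (suc k) = ℕP.*-zeroʳ (suc (suc k))
C-absorb (suc n) zero    =
  trans (ℕP.+-identityʳ _) (trans (nC1≡n (suc (suc n))) (sym (ℕP.*-identityʳ _)))
C-absorb (suc n) (suc k) = begin
  (2 + k) * ((2 + n) C (2 + k))
    ≡⟨ cong ((2 + k) *_) (C-pascal (suc n) (suc k)) ⟩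
  (2 + k) * ((1 + n) C (1 + k) + (1 + n) C (2 + k))
    ≡⟨ split k ((1 + n) C (1 + k)) ((1 + n) C (2 + k)) ⟩
  (1 + n) C (1 + k) + ((1 + k) * ((1 + n) C (1 + k)) + (2 + k) * ((1 + n) C (2 + k)))
    ≡⟨ cong₂ (λ a b → (1 + n) C (1 + k) + (a + b)) (C-absorb n k) (C-absorb n (suc k)) ⟩
  (1 + n) C (1 + k) + ((1 + n) * (n C k) + (1 + n) * (n C (1 + k)))
    ≡⟨ cong (λ c → (1 + n) C (1 + k) + c) (sym (ℕP.*-distribˡ-+ (1 + n) (n C k) (n C (1 + k)))) ⟩
  (1 + n) C (1 + k) + (1 + n) * (n C k + n C (1 + k))
    ≡⟨ cong (λ c → (1 + n) C (1 + k) + (1 + n) * c) (sym (C-pascal n k)) ⟩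
  (2 + n) * ((1 + n) C (1 + k)) ∎
  where
  split : ∀ k a b → (2 + k) * (a + b) ≡ a + ((1 + k) * a + (2 + k) * b)
  split = solve-∀

C-ratio : ∀ n k r → n ≡ k + r → suc k * (n C suc k) ≡ r * (n C k)
C-ratio n k r n≡k+r = ℕP.+-cancelʳ-≡ (suc k * (n C k)) _ _ (begin
  suc k * (n C suc k) + suc k * (n C k) ≡⟨ ℕP.+-comm (suc k * (n C suc k)) _ ⟩
  suc k * (n C k) + suc k * (n C suc k) ≡⟨ sym (ℕP.*-distribˡ-+ (suc k) (n C k) _) ⟩
  suc k * (n C k + n C suc k)           ≡⟨ cong (suc k *_) (sym (C-pascal n k)) ⟩
  suc k * (suc n C suc k)               ≡⟨ C-absorb n k ⟩
  suc n * (n C k)                       ≡⟨ cong (λ m → suc m * (n C k)) n≡k+r ⟩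
  suc (k + r) * (n C k)                 ≡⟨ split (n C k) k r ⟩
  r * (n C k) + suc k * (n C k)         ∎)
  where
  split : ∀ c k r → suc (k + r) * c ≡ r * c + suc k * c
  split = solve-∀

-- n C (u − 1), except that choosePrev n 0 is 0 rather than the truncated n C 0 = 1.
choosePrev : ℕ → ℕ → ℕ
choosePrev n zero    = 0
choosePrev n (suc u) = n C u

C-pascal-prev : ∀ n u → suc n C u ≡ choosePrev n u + n C u
C-pascal-prev n zero    = refl
C-pascal-prev n (suc u) = C-pascal n u

choosePrev-ratio : ∀ n u r → n ≡ u + r → u * (n C u) ≡ suc r * choosePrev n u
choosePrev-ratio n zero    r _     = sym (ℕP.*-zeroʳ (suc r))
choosePrev-ratio n (suc u) r n≡u+r = C-ratio n u (suc r) (trans n≡u+r (sym (ℕP.+-suc u r)))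

C-suc≡2*C : ∀ n v → n ≡ 3 * v + 2 → n C suc v ≡ 2 * (n C v)
C-suc≡2*C n v n≡3v+2 = ℕP.*-cancelˡ-≡ _ _ (suc v) (begin
  suc v * (n C suc v)   ≡⟨ C-ratio n v (2 * v + 2) (trans n≡3v+2 (split v)) ⟩
  (2 * v + 2) * (n C v) ≡⟨ regroup v (n C v) ⟩
  suc v * (2 * (n C v)) ∎)
  where
  split : ∀ v → 3 * v + 2 ≡ v + (2 * v + 2)
  split = solve-∀
  regroup : ∀ v c → (2 * v + 2) * c ≡ suc v * (2 * c)
  regroup = solve-∀

-- paths a b k counts the walks of length k in ℕ from a to b with steps −1 and +2.
paths : ℕ → ℕ → ℕ → ℕ
paths zero    b       (suc k) = paths 2 b k
paths (suc a) b       (suc k) = paths a b k + paths (3 + a) b k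
paths zero    zero    zero    = 1
paths zero    (suc b) zero    = 0
paths (suc a) zero    zero    = 0
paths (suc a) (suc b) zero    = paths a b zero

pathsEndingUp : ℕ → ℕ → ℕ → ℕ
pathsEndingUp a (suc (suc b)) k = paths a b k
pathsEndingUp a _             k = 0

pathsEndingUp-suc-zero : ∀ b k → pathsEndingUp 0 b (suc k) ≡ pathsEndingUp 2 b k
pathsEndingUp-suc-zero zero          k = refl
pathsEndingUp-suc-zero (suc zero)    k = refl
pathsEndingUp-suc-zero (suc (suc b)) k = refl

pathsEndingUp-suc-suc : ∀ a b k →
  pathsEndingUp (suc a) b (suc k) ≡ pathsEndingUp a b k + pathsEndingUp (3 + a) b k
pathsEndingUp-suc-suc a zero          k = refl
pathsEndingUp-suc-suc a (suc zero)    k = refl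
pathsEndingUp-suc-suc a (suc (suc b)) k = refl

paths-suc-last : ∀ k a b → paths a b (suc k) ≡ paths a (suc b) k + pathsEndingUp a b k
paths-suc-last zero    zero    zero          = refl
paths-suc-last zero    zero    (suc zero)    = refl
paths-suc-last zero    zero    (suc (suc b)) = refl
paths-suc-last zero    (suc a) zero          = refl
paths-suc-last zero    (suc a) (suc zero)    = refl
paths-suc-last zero    (suc a) (suc (suc b)) = refl
paths-suc-last (suc k) zero    b =
  trans (paths-suc-last k 2 b) (cong₂ _+_ refl (sym (pathsEndingUp-suc-zero b k)))
paths-suc-last (suc k) (suc a) b = begin
  paths a b (suc k) + paths (3 + a) b (suc k)
    ≡⟨ cong₂ _+_ (paths-suc-last k a b) (paths-suc-last k (3 + a) b) ⟩
  (paths a (suc b) k + pathsEndingUp a b k) + (paths (3 + a) (suc b) k + pathsEndingUp (3 + a) b k)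
    ≡⟨ interchange (paths a (suc b) k) _ _ _ ⟩
  paths (suc a) (suc b) (suc k) + (pathsEndingUp a b k + pathsEndingUp (3 + a) b k)
    ≡⟨ cong₂ _+_ refl (sym (pathsEndingUp-suc-suc a b k)) ⟩
  paths (suc a) (suc b) (suc k) + pathsEndingUp (suc a) b (suc k) ∎

-- Every step moves by 2 modulo 3.
paths-to-0-vanishes : ∀ k h → (∀ u → k ≢ 3 * u + h) → paths h 0 k ≡ 0
paths-to-0-vanishes zero    zero    k≢ = ⊥-elim (k≢ 0 refl)
paths-to-0-vanishes zero    (suc h) _  = refl
paths-to-0-vanishes (suc k) zero    k≢ =
  paths-to-0-vanishes k 2 (λ u k≡ → k≢ (suc u) (trans (cong suc k≡) (lift u)))
  where
  lift : ∀ u → suc (3 * u + 2) ≡ 3 * suc u + 0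
  lift = solve-∀
paths-to-0-vanishes (suc k) (suc h) k≢ = cong₂ _+_
  (paths-to-0-vanishes k h (λ u k≡ → k≢ u (trans (cong suc k≡) (sym (ℕP.+-suc (3 * u) h)))))
  (paths-to-0-vanishes k (3 + h) (λ u k≡ → k≢ (suc u) (trans (cong suc k≡) (lift u h))))
  where
  lift : ∀ u h → suc (3 * u + (3 + h)) ≡ 3 * suc u + suc h
  lift = solve-∀

paths-to-0-off-residue : ∀ m r h → r < 3 → h < 3 → r ≢ h → paths h 0 (3 * m + r) ≡ 0
paths-to-0-off-residue m r h r<3 h<3 r≢h =
  paths-to-0-vanishes (3 * m + r) h (λ u eq → r≢h (residue-unique 3 m u r<3 h<3 eq))

paths-to-0-ballot : ∀ k h u → k ≡ 3 * u + h → paths h 0 k + 2 * choosePrev k u ≡ k C u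
paths-to-0-ballot zero    zero    zero    _  = refl
paths-to-0-ballot (suc k) zero    (suc v) k≡ = begin
  paths 2 0 k + 2 * (suc k C v)
    ≡⟨ cong (λ c → paths 2 0 k + 2 * c) (C-pascal-prev k v) ⟩
  paths 2 0 k + 2 * (choosePrev k v + k C v)
    ≡⟨ regroup (paths 2 0 k) (choosePrev k v) (k C v) ⟩
  (paths 2 0 k + 2 * choosePrev k v) + 2 * (k C v)
    ≡⟨ cong₂ _+_ (paths-to-0-ballot k 2 v k≡3v+2) (sym (C-suc≡2*C k v k≡3v+2)) ⟩
  k C v + k C suc v
    ≡⟨ sym (C-pascal k v) ⟩
  suc k C suc v ∎
  where
  k≡3v+2 : k ≡ 3 * v + 2
  k≡3v+2 = ℕP.suc-injective (trans k≡ (shift v))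
    where
    shift : ∀ v → 3 * suc v + 0 ≡ suc (3 * v + 2)
    shift = solve-∀
  regroup : ∀ x p c → x + 2 * (p + c) ≡ (x + 2 * p) + 2 * c
  regroup = solve-∀
paths-to-0-ballot (suc k) (suc h) zero    k≡ = begin
  (paths h 0 k + paths (3 + h) 0 k) + 0
    ≡⟨ cong (λ p → (paths h 0 k + p) + 0) (paths-to-0-vanishes k (3 + h) k≢) ⟩
  (paths h 0 k + 0) + 0
    ≡⟨ ℕP.+-identityʳ _ ⟩
  paths h 0 k + 0
    ≡⟨ paths-to-0-ballot k h 0 k≡h ⟩
  1 ∎
  where
  k≡h : k ≡ h
  k≡h = ℕP.suc-injective k≡
  k≢ : ∀ u → k ≢ 3 * u + (3 + h)
  k≢ u k≡ = ℕP.m≢1+n+m h (trans (sym k≡h) (trans k≡ (shift u h)))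
    where
    shift : ∀ u h → 3 * u + (3 + h) ≡ suc (2 + 3 * u + h)
    shift = solve-∀
paths-to-0-ballot (suc k) (suc h) (suc v) k≡ = begin
  (paths h 0 k + paths (3 + h) 0 k) + 2 * (suc k C v)
    ≡⟨ cong (λ c → (paths h 0 k + paths (3 + h) 0 k) + 2 * c) (C-pascal-prev k v) ⟩
  (paths h 0 k + paths (3 + h) 0 k) + 2 * (choosePrev k v + k C v)
    ≡⟨ regroup (paths h 0 k) (paths (3 + h) 0 k) (choosePrev k v) (k C v) ⟩
  (paths h 0 k + 2 * (k C v)) + (paths (3 + h) 0 k + 2 * choosePrev k v)
    ≡⟨ cong₂ _+_ (paths-to-0-ballot k h (suc v) k≡3[1+v]+h)
                 (paths-to-0-ballot k (3 + h) v k≡3v+3+h) ⟩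
  k C suc v + k C v
    ≡⟨ trans (ℕP.+-comm (k C suc v) _) (sym (C-pascal k v)) ⟩
  suc k C suc v ∎
  where
  k≡3[1+v]+h : k ≡ 3 * suc v + h
  k≡3[1+v]+h = ℕP.suc-injective (trans k≡ (ℕP.+-suc (3 * suc v) h))
  k≡3v+3+h : k ≡ 3 * v + (3 + h)
  k≡3v+3+h = trans k≡3[1+v]+h (shift v h)
    where
    shift : ∀ v h → 3 * suc v + h ≡ 3 * v + (3 + h)
    shift = solve-∀
  regroup : ∀ x y p c → (x + y) + 2 * (p + c) ≡ (x + 2 * c) + (y + 2 * p)
  regroup = solve-∀

paths-to-0-closed-form : ∀ n h u → n ≡ 3 * u + h → (2 * u + suc h) * paths h 0 n ≡ suc h * (n C u)
paths-to-0-closed-form n h u n≡ = ℕP.+-cancelʳ-≡ (2 * (u * c)) _ _ (begin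
  s * X + 2 * (u * c)        ≡⟨ cong (λ t → s * X + 2 * t) (choosePrev-ratio n u (2 * u + h) n≡u+r) ⟩
  s * X + 2 * (suc (2 * u + h) * p)
                             ≡⟨ cong (λ t → s * X + 2 * (t * p)) (sym (ℕP.+-suc (2 * u) h)) ⟩
  s * X + 2 * (s * p)        ≡⟨ factor s X p ⟩
  s * (X + 2 * p)            ≡⟨ cong (s *_) (paths-to-0-ballot n h u n≡) ⟩
  s * c                      ≡⟨ split u h c ⟩
  suc h * c + 2 * (u * c)    ∎)
  where
  s = 2 * u + suc h
  X = paths h 0 n
  c = n C u
  p = choosePrev n u
  n≡u+r : n ≡ u + (2 * u + h)
  n≡u+r = trans n≡ (shift u h)
    where
    shift : ∀ u h → 3 * u + h ≡ u + (2 * u + h)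
    shift = solve-∀
  factor : ∀ s X p → s * X + 2 * (s * p) ≡ s * (X + 2 * p)
  factor = solve-∀
  split : ∀ u h c → (2 * u + suc h) * c ≡ suc h * c + 2 * (u * c)
  split = solve-∀

-- Walks of the gap from g counted through their reversals, which are paths from 0 or 1 to g − 1.
gapWalks : ℤ → ℕ → ℕ
gapWalks +[1+ g ] k = paths 0 g k + paths 1 g k
gapWalks _        k = 0

gapWalks-nonpos : ∀ g k → g ℤ.≤ + 0 → gapWalks g k ≡ 0
gapWalks-nonpos (+ zero)   k _          = refl
gapWalks-nonpos +[1+ g ]   k (ℤ.+≤+ ())
gapWalks-nonpos -[1+ g ]   k _          = refl

gapWalks-zero : ∀ g → ¬ (g ≡ + 1 ⊎ g ≡ + 2) → gapWalks g 0 ≡ 0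
gapWalks-zero (+ 0)                 _   = refl
gapWalks-zero (+ 1)                 g∉ = ⊥-elim (g∉ (inj₁ refl))
gapWalks-zero (+ 2)                 g∉ = ⊥-elim (g∉ (inj₂ refl))
gapWalks-zero +[1+ suc (suc g) ]    _   = refl
gapWalks-zero -[1+ g ]              _   = refl

gapWalks-suc : ∀ g k → + 0 ℤ.< g →
               gapWalks g (suc k) ≡ gapWalks (g ℤ.+ + 1) k + gapWalks (g - + 2) k
gapWalks-suc +[1+ g ] k _ = begin
  paths 0 g (suc k) + paths 1 g (suc k)
    ≡⟨ cong₂ _+_ (paths-suc-last k 0 g) (paths-suc-last k 1 g) ⟩
  (paths 0 (suc g) k + pathsEndingUp 0 g k) + (paths 1 (suc g) k + pathsEndingUp 1 g k)
    ≡⟨ interchange (paths 0 (suc g) k) _ _ _ ⟩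
  gapWalks +[1+ suc g ] k + (pathsEndingUp 0 g k + pathsEndingUp 1 g k)
    ≡⟨ cong₂ _+_ (cong (λ i → gapWalks +[1+ i ] k) (ℕP.+-comm 1 g)) (endingUp≡gapWalks g) ⟩
  gapWalks (+[1+ g ] ℤ.+ + 1) k + gapWalks (+[1+ g ] - + 2) k ∎
  where
  endingUp≡gapWalks : ∀ g → pathsEndingUp 0 g k + pathsEndingUp 1 g k ≡ gapWalks (+[1+ g ] - + 2) k
  endingUp≡gapWalks zero          = refl
  endingUp≡gapWalks (suc zero)    = refl
  endingUp≡gapWalks (suc (suc g)) = refl
gapWalks-suc (+ zero) k (ℤ.+<+ ())

GoodFrom : ℤ → ℤ → ∀ {k} → Vec Step k → Set
GoodFrom n s xs = All (ℤ._< n) (sums s xs) × (final s xs ≡ n - + 1 ⊎ final s xs ≡ n - + 2)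

goodFrom? : (n s : ℤ) → ∀ {k} (xs : Vec Step k) → Dec (GoodFrom n s xs)
goodFrom? n s xs = All.all? (ℤ._<? n) (sums s xs)
  ×-dec ((final s xs ℤP.≟ (n - + 1)) ⊎-dec (final s xs ℤP.≟ (n - + 2)))

countFrom : ℤ → ℤ → ℕ → ℕ
countFrom n s k = length (filter (goodFrom? n s) (allSeqs k))

goodFrom-[] : ∀ n s → n - s ≡ + 1 ⊎ n - s ≡ + 2 → GoodFrom n s []
goodFrom-[] n s gap∈ =
  0<j-i⇒i<j (positive gap∈) ∷ [] , Sum.map (final≡ (+ 1)) (final≡ (+ 2)) gap∈
  where
  positive : n - s ≡ + 1 ⊎ n - s ≡ + 2 → + 0 ℤ.< n - s
  positive (inj₁ gap≡1) = subst (+ 0 ℤ.<_) (sym gap≡1) (ℤ.+<+ (s≤s z≤n))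
  positive (inj₂ gap≡2) = subst (+ 0 ℤ.<_) (sym gap≡2) (ℤ.+<+ (s≤s z≤n))
  final≡ : ∀ g → n - s ≡ g → s ≡ n - g
  final≡ g gap≡g = trans (sym (j-[j-i]≡i n s)) (cong (n -_) gap≡g)

countFrom-zero : ∀ n s → countFrom n s 0 ≡ gapWalks (n - s) 0
countFrom-zero n s = by-decision (goodFrom? n s [])
  where
  gap∈ : GoodFrom n s [] → gapWalks (n - s) 0 ≡ 1
  gap∈ (_ ∷ [] , inj₁ s≡n-1) = cong (λ g → gapWalks g 0) (trans (cong (n -_) s≡n-1) (j-[j-i]≡i n (+ 1)))
  gap∈ (_ ∷ [] , inj₂ s≡n-2) = cong (λ g → gapWalks g 0) (trans (cong (n -_) s≡n-2) (j-[j-i]≡i n (+ 2)))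
  by-decision : Dec (GoodFrom n s []) → countFrom n s 0 ≡ gapWalks (n - s) 0
  by-decision (yes good) = trans (cong length (filter-accept (goodFrom? n s) {x = []} {xs = []} good))
                                 (sym (gap∈ good))
  by-decision (no ¬good) = trans (cong length (filter-reject (goodFrom? n s) {x = []} {xs = []} ¬good))
                                 (sym (gapWalks-zero (n - s) (¬good ∘ goodFrom-[] n s)))

countFromFirst : ℤ → ℤ → Step → ℕ → ℕ
countFromFirst n s x k = length (filter (goodFrom? n s) (map (x ∷_) (allSeqs k)))

countFrom-suc : ∀ n s k → countFrom n s (suc k) ≡ countFromFirst n s down k + countFromFirst n s up k
countFrom-suc n s k =
  length-filter-++ (goodFrom? n s) (map (down ∷_) (allSeqs k)) (map (up ∷_) (allSeqs k))

countFromFirst-below : ∀ n s x k → s ℤ.< n → countFromFirst n s x k ≡ countFrom n (s ℤ.+ val x) k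
countFromFirst-below n s x k s<n = trans (length-filter-map (goodFrom? n s) (x ∷_) (allSeqs k))
  (cong length (filter-≐ (goodFrom? n s ∘ (x ∷_)) (goodFrom? n (s ℤ.+ val x))
                         (map₁ All.tail , map₁ (s<n ∷_)) (allSeqs k)))

countFromFirst-blocked : ∀ n s x k → ¬ s ℤ.< n → countFromFirst n s x k ≡ 0
countFromFirst-blocked n s x k s≮n = trans (length-filter-map (goodFrom? n s) (x ∷_) (allSeqs k))
  (cong length (filter-none (goodFrom? n s ∘ (x ∷_))
                            (All.universal (λ _ → s≮n ∘ All.head ∘ proj₁) (allSeqs k))))

countFrom≡gapWalks : ∀ k n s → countFrom n s k ≡ gapWalks (n - s) k
countFrom≡gapWalks zero    n s = countFrom-zero n s
countFrom≡gapWalks (suc k) n s with s ℤ.<? n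
... | yes s<n = begin
  countFrom n s (suc k)
    ≡⟨ countFrom-suc n s k ⟩
  countFromFirst n s down k + countFromFirst n s up k
    ≡⟨ cong₂ _+_ (countFromFirst-below n s down k s<n) (countFromFirst-below n s up k s<n) ⟩
  countFrom n (s ℤ.+ val down) k + countFrom n (s ℤ.+ val up) k
    ≡⟨ cong₂ _+_ (countFrom≡gapWalks k n _) (countFrom≡gapWalks k n _) ⟩
  gapWalks (n - (s ℤ.+ val down)) k + gapWalks (n - (s ℤ.+ val up)) k
    ≡⟨ cong₂ (λ g h → gapWalks g k + gapWalks h k) (gap-down n s) (gap-up n s) ⟩
  gapWalks ((n - s) ℤ.+ + 1) k + gapWalks ((n - s) - + 2) k
    ≡⟨ sym (gapWalks-suc (n - s) k (i<j⇒0<j-i s<n)) ⟩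
  gapWalks (n - s) (suc k) ∎
  where
  gap-down : ∀ n s → n - (s ℤ.+ -[1+ 0 ]) ≡ (n - s) ℤ.+ + 1
  gap-down = solveℤ-∀
  gap-up : ∀ n s → n - (s ℤ.+ + 2) ≡ (n - s) - + 2
  gap-up = solveℤ-∀
... | no s≮n = begin
  countFrom n s (suc k)
    ≡⟨ countFrom-suc n s k ⟩
  countFromFirst n s down k + countFromFirst n s up k
    ≡⟨ cong₂ _+_ (countFromFirst-blocked n s down k s≮n) (countFromFirst-blocked n s up k s≮n) ⟩
  0
    ≡⟨ sym (gapWalks-nonpos (n - s) (suc k) (ℤP.i≤j⇒i-j≤0 (ℤP.≮⇒≥ s≮n))) ⟩
  gapWalks (n - s) (suc k) ∎

D≡gapWalks : ∀ n k → D n k ≡ gapWalks n k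
D≡gapWalks n k = trans (countFrom≡gapWalks k n (+ 0)) (cong (λ g → gapWalks g k) (ℤP.+-identityʳ n))

D-suc : ∀ n k → n ≥ + 2 → D (n - + 1) (suc k) ≡ D n k + D (n - + 3) k
D-suc n k n≥2 = begin
  D (n - + 1) (suc k)
    ≡⟨ D≡gapWalks (n - + 1) (suc k) ⟩
  gapWalks (n - + 1) (suc k)
    ≡⟨ gapWalks-suc (n - + 1) k (i<j⇒0<j-i (ℤP.<-≤-trans (ℤ.+<+ (s≤s (s≤s z≤n))) n≥2)) ⟩
  gapWalks (n - + 1 ℤ.+ + 1) k + gapWalks (n - + 1 - + 2) k
    ≡⟨ cong₂ (λ g h → gapWalks g k + gapWalks h k) (n-1+1≡n n) (n-1-2≡n-3 n) ⟩
  gapWalks n k + gapWalks (n - + 3) k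
    ≡⟨ sym (cong₂ _+_ (D≡gapWalks n k) (D≡gapWalks (n - + 3) k)) ⟩
  D n k + D (n - + 3) k ∎
  where
  n-1+1≡n : ∀ n → n - + 1 ℤ.+ + 1 ≡ n
  n-1+1≡n = solveℤ-∀
  n-1-2≡n-3 : ∀ n → n - + 1 - + 2 ≡ n - + 3
  n-1-2≡n-3 = solveℤ-∀

D-recurrence : ∀ n k → n ≥ + 2 → + D n k ≡ + D (n - + 1) (suc k) - + D (n - + 3) k
D-recurrence n k n≥2 = begin
  + D n k                                   ≡⟨ sym (i+j-j≡i (+ D n k) (+ D (n - + 3) k)) ⟩
  + (D n k + D (n - + 3) k) - + D (n - + 3) k ≡⟨ cong (λ d → + d - + D (n - + 3) k) (sym (D-suc n k n≥2)) ⟩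
  + D (n - + 1) (suc k) - + D (n - + 3) k   ∎
  where
  i+j-j≡i : ∀ i j → i ℤ.+ j - j ≡ i
  i+j-j≡i = solveℤ-∀

D-nonpos : ∀ n k → n ℤ.≤ + 0 → D n k ≡ 0
D-nonpos n k n≤0 = trans (D≡gapWalks n k) (gapWalks-nonpos n k n≤0)

D-1 : ∀ k → D (+ 1) k ≡ paths 0 0 k + paths 1 0 k
D-1 = D≡gapWalks (+ 1)

D-1-[3m] : ∀ m → (2 * m + 1) * D (+ 1) (3 * m) ≡ (3 * m) C m
D-1-[3m] m = begin
  (2 * m + 1) * D (+ 1) (3 * m)               ≡⟨ cong ((2 * m + 1) *_) (D-1 (3 * m)) ⟩
  (2 * m + 1) * (paths 0 0 (3 * m) + paths 1 0 (3 * m))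
    ≡⟨ cong (λ p → (2 * m + 1) * (paths 0 0 (3 * m) + p)) paths-1-0≡0 ⟩
  (2 * m + 1) * (paths 0 0 (3 * m) + 0)       ≡⟨ cong ((2 * m + 1) *_) (ℕP.+-identityʳ _) ⟩
  (2 * m + 1) * paths 0 0 (3 * m)             ≡⟨ paths-to-0-closed-form (3 * m) 0 m (sym (ℕP.+-identityʳ _)) ⟩
  1 * ((3 * m) C m)                           ≡⟨ ℕP.*-identityˡ _ ⟩
  (3 * m) C m                                 ∎
  where
  paths-1-0≡0 : paths 1 0 (3 * m) ≡ 0
  paths-1-0≡0 = trans (cong (paths 1 0) (sym (ℕP.+-identityʳ (3 * m))))
                      (paths-to-0-off-residue m 0 1 (s≤s z≤n) (s≤s (s≤s z≤n)) (λ ()))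

D-1-[3m+1] : ∀ m → (2 * m + 1) * D (+ 1) (3 * m + 1) ≡ (3 * m + 1) C (m + 1)
D-1-[3m+1] m = trans (cong ((2 * m + 1) *_) D≡Y) (begin
  (2 * m + 1) * Y ≡⟨ ℕP.*-cancelˡ-≡ _ _ (suc m) (begin
     suc m * ((2 * m + 1) * Y) ≡⟨ swap (suc m) (2 * m + 1) Y ⟩
     (2 * m + 1) * (suc m * Y) ≡⟨ cong ((2 * m + 1) *_) [1+m]*Y≡c ⟩
     (2 * m + 1) * c           ≡⟨ sym (C-ratio n m (2 * m + 1) (split m)) ⟩
     suc m * (n C suc m)       ∎) ⟩
  n C suc m       ≡⟨ cong (n C_) (ℕP.+-comm 1 m) ⟩
  n C (m + 1)     ∎)
  where
  n = 3 * m + 1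
  Y = paths 1 0 n
  c = n C m
  D≡Y : D (+ 1) n ≡ Y
  D≡Y = trans (D-1 n)
              (cong (_+ Y) (paths-to-0-off-residue m 1 0 (s≤s (s≤s z≤n)) (s≤s z≤n) (λ ())))
  double : ∀ m Y → 2 * (suc m * Y) ≡ (2 * m + 2) * Y
  double = solve-∀
  [1+m]*Y≡c : suc m * Y ≡ c
  [1+m]*Y≡c = ℕP.*-cancelˡ-≡ _ _ 2 (trans (double m Y) (paths-to-0-closed-form n 1 m refl))
  swap : ∀ a b Y → a * (b * Y) ≡ b * (a * Y)
  swap = solve-∀
  split : ∀ m → 3 * m + 1 ≡ m + (2 * m + 1)
  split = solve-∀

D-1-[3m+2] : ∀ m → D (+ 1) (3 * m + 2) ≡ 0
D-1-[3m+2] m = trans (D-1 (3 * m + 2)) (cong₂ _+_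
  (paths-to-0-off-residue m 2 0 ℕP.≤-refl (s≤s z≤n) (λ ()))
  (paths-to-0-off-residue m 2 1 ℕP.≤-refl (s≤s (s≤s z≤n)) (λ ())))

lemma6 : ((n : ℤ) (k : ℕ) → n ≥ + 2 →
           + D n k ≡ + D (n - + 1) (suc k) - + D (n - + 3) k)
       × ((k : ℕ) → D (+ 0 - + 1) k ≡ 0 × D (+ 0) k ≡ 0)
       × ((m : ℕ) →
           ((2 * m +ℕ 1) * D (+ 1) (3 * m) ≡ (3 * m) C m)
         × ((2 * m +ℕ 1) * D (+ 1) (3 * m +ℕ 1) ≡ (3 * m +ℕ 1) C (m +ℕ 1))
         × D (+ 1) (3 * m +ℕ 2) ≡ 0)
lemma6 = D-recurrence
       , (λ k → D-nonpos (+ 0 - + 1) k ℤ.-≤+ , D-nonpos (+ 0) k (ℤ.+≤+ z≤n))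
       , λ m → D-1-[3m] m , D-1-[3m+1] m , D-1-[3m+2] m
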